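{- For variables $a$, $z$ and $q$ (say as formal power series in $q$, or for $|q|<1$), we have \[ \sum_{n\geq0} \frac{(za;q)_n\,(z q^{n+1};q)_\infty}{(q;q)_n}\, z^n q^{\frac{n(n+1)}{2}} = \sum_{n\geq0} \frac{(-za;q)_n\,(-zq^{n+1};q)_\infty}{(q;q)_n}\,(-z)^n q^{\frac{n(n+1)}{2}}. \]
   Context: The $q$-Pochhammer symbol is $(a;q)_n=\prod_{i=0}^{n-1}(1-aq^i)$ for $n\in\mathbb{Z}_{\ge 0}\cup\{\infty\}$. -}

module Defs where

open import Level using (Level)
open import Algebra.Bundles using (CommutativeRing)
open import Data.Nat as ℕ using (ℕ; zero; suc; _∸_; _≡ᵇ_)
open import Data.Nat.DivMod using (_/_)
open import Data.Bool using (if_then_else_)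
open import Data.List using (List; []; _∷_; map; zipWith; foldr; upTo)

-- Formal power series in q with coefficients in a commutative ring R,
-- represented by their coefficient sequences.
module PowerSeries {c ℓ : Level} (R : CommutativeRing c ℓ) where
  open CommutativeRing R

  Series : Set c
  Series = ℕ → Carrier

  sumBelow : (ℕ → Carrier) → ℕ → Carrier
  sumBelow f zero    = 0#
  sumBelow f (suc n) = sumBelow f n + f n

  pow : Carrier → ℕ → Carrier
  pow x zero    = 1#
  pow x (suc n) = x * pow x n

  oneS : Series
  oneS zero    = 1#
  oneS (suc _) = 0#

  mono : Carrier → ℕ → Series
  mono x k N = if N ≡ᵇ k then x else 0#

  _⊛_ : Series → Series → Series
  (f ⊛ g) N = sumBelow (λ i → f i * g (N ∸ i)) (suc N)

  oneMinus : Carrier → ℕ → Series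
  oneMinus x k N = oneS N - mono x k N

  poch : Carrier → ℕ → ℕ → Series
  poch x s zero    = oneS
  poch x s (suc n) = poch x s n ⊛ oneMinus x (s ℕ.+ n)

  -- infinite q-Pochhammer (x q^s ; q)_∞ for s ≥ 1, as a q-adic limit:
  -- its coefficient of q^N is that of the finite product with N+1 factors
  -- (all further factors are ≡ 1 mod q^{N+1} since s ≥ 1).
  pochInf : Carrier → ℕ → Series
  pochInf x s N = poch x s (suc N) N

  -- Multiplicative inverse of a series f with f 0 = 1:
  -- invRev f N = [b_N , … , b_0] where b_0 = 1 and
  -- b_{N+1} = - Σ_{j=0}^{N} f (j+1) * b_{N-j}.
  sumL : List Carrier → Carrier
  sumL = foldr _+_ 0#

  invRev : Series → ℕ → List Carrier
  invRev f zero    = 1# ∷ []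
  invRev f (suc N) =
    (- sumL (zipWith _*_ (map (λ j → f (suc j)) (upTo (suc N))) (invRev f N)))
      ∷ invRev f N

  headOr0 : List Carrier → Carrier
  headOr0 []      = 0#
  headOr0 (x ∷ _) = x

  inv : Series → Series
  inv f N = headOr0 (invRev f N)

  tri : ℕ → ℕ
  tri n = (n ℕ.* suc n) / 2

  summand : Carrier → Carrier → Carrier → ℕ → Series
  summand c d e n =
    ((poch c 0 n ⊛ pochInf d (suc n)) ⊛ inv (poch 1# 1 n)) ⊛ mono (pow e n) (tri n)

  -- Σ_{n ≥ 0} summand n, as a q-adic limit: the n-th summand is
  -- divisible by q^{n(n+1)/2}, so only n ≤ N contribute to the coefficient of q^N.
  sumSeries : (ℕ → Series) → Series
  sumSeries t N = sumBelow (λ n → t n N) (suc N)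

  LHS : Carrier → Carrier → Series
  LHS a z = sumSeries (summand (z * a) z z)

  RHS : Carrier → Carrier → Series
  RHS a z = sumSeries (summand (- (z * a)) (- z) (- z))

-- Both sides are Φ_0, for (x, z) = (za, z) and (−za, −z), of the family
--   Φ_s(x, z) = Σ_n (x;q)_n (zq^{s+n+1};q)_∞ / (q;q)_n · z^n q^{sn + n(n+1)/2}.
-- Splitting off one factor of (zq^{s+n+1};q)_∞, shifting n by one and re-collecting gives the recurrence
--   Φ_s = Φ_{s+1} + (z² q^{2s+3} − xz q^{s+1}) Φ_{s+2},
-- and Φ_s ≡ 1 mod q^{s+1}. The recurrence and the initial coefficients determine Φ_s completely, and both
-- depend on (x, z) only through z² and xz, which are unchanged by (x, z) ↦ (−x, −z).
module Submission where

open import Defs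
open import Level using (Level)
open import Algebra.Bundles using (CommutativeRing)
open import Data.Integer as ℤ using (ℤ; +_; -[1+_]; _⊖_; sign; ∣_∣; _◃_)
import Data.Integer.Properties as ℤₚ
open import Data.List using (map; zipWith; applyUpTo)
open import Data.Maybe using (Maybe; just; nothing)
open import Data.Nat as ℕ using (ℕ; zero; suc; _∸_; _≤_; _<_; z≤n; s≤s)
import Data.Nat.Properties as ℕₚ
open import Data.Nat.DivMod using (_/_; +-distrib-/-∣ʳ; m*n/n≡m)
open import Data.Nat.Divisibility using (n∣m*n)
open import Data.Nat.Solver using (module +-*-Solver)
open import Data.Product using (_,_)
open import Data.Sign as Sign using (Sign)
open import Data.Sum using (inj₁; inj₂)
open import Relation.Nullary using (yes; no)
open import Relation.Binary.PropositionalEquality as ≡ using (_≡_)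
import Relation.Binary.Reasoning.Setoid as SetoidReasoning
import Algebra.Solver.Ring
import Algebra.Solver.Ring.AlmostCommutativeRing as ACR

-- The ring solver needs coefficients with decidable equality; for an arbitrary commutative ring
-- we take them in ℤ, interpreted through the canonical map ℤ → R.
module IntegerCoefficientSolver {c ℓ : Level} (R : CommutativeRing c ℓ) where
  open CommutativeRing R hiding (zero)
  open import Algebra.Properties.Semiring.Mult semiring using (_×_; ×-homo-+; ×1-homo-*)
  open import Algebra.Properties.Ring ring
    using (-‿involutive; -‿distribʳ-*; -0#≈0#; -‿+-comm; -1*x≈-x)
  open import Algebra.Properties.CommutativeSemigroup +-commutativeSemigroup
    using () renaming (interchange to +-interchange)
  open import Algebra.Properties.CommutativeSemigroup *-commutativeSemigroup
    using () renaming (interchange to *-interchange)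
  open SetoidReasoning setoid

  fromℕ : ℕ → Carrier
  fromℕ n = n × 1#

  fromℤ : ℤ → Carrier
  fromℤ (+ n)    = fromℕ n
  fromℤ -[1+ n ] = - fromℕ (suc n)

  fromℤ-neg : ∀ i → fromℤ (ℤ.- i) ≈ - fromℤ i
  fromℤ-neg -[1+ n ]  = sym (-‿involutive _)
  fromℤ-neg (+ zero)  = sym -0#≈0#
  fromℤ-neg (+ suc n) = refl

  +-cancelˡ-minus : ∀ a x y → (a + x) - (a + y) ≈ x - y
  +-cancelˡ-minus a x y = begin
    (a + x) + - (a + y)   ≈⟨ +-congˡ (-‿+-comm a y) ⟨
    (a + x) + (- a + - y) ≈⟨ +-interchange a x (- a) (- y) ⟩
    (a - a) + (x - y)     ≈⟨ +-congʳ (-‿inverseʳ a) ⟩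
    0# + (x - y)          ≈⟨ +-identityˡ _ ⟩
    x - y                 ∎

  fromℤ-⊖ : ∀ m n → fromℤ (m ⊖ n) ≈ fromℕ m - fromℕ n
  fromℤ-⊖ m       zero    = sym (trans (+-congˡ -0#≈0#) (+-identityʳ _))
  fromℤ-⊖ zero    (suc n) = sym (+-identityˡ _)
  fromℤ-⊖ (suc m) (suc n) rewrite ℤₚ.[1+m]⊖[1+n]≡m⊖n m n =
    trans (fromℤ-⊖ m n) (sym (+-cancelˡ-minus 1# (fromℕ m) (fromℕ n)))

  fromℤ-+ : ∀ i j → fromℤ (i ℤ.+ j) ≈ fromℤ i + fromℤ j
  fromℤ-+ (+ m)    (+ n)    = ×-homo-+ 1# m n
  fromℤ-+ (+ m)    -[1+ n ] = fromℤ-⊖ m (suc n)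
  fromℤ-+ -[1+ m ] (+ n)    = trans (fromℤ-⊖ n (suc m)) (+-comm _ _)
  fromℤ-+ -[1+ m ] -[1+ n ] = begin
    - fromℕ (suc (suc (m ℕ.+ n)))     ≡⟨ ≡.cong (λ k → - fromℕ (suc k)) (ℕₚ.+-suc m n) ⟨
    - fromℕ (suc m ℕ.+ suc n)         ≈⟨ -‿cong (×-homo-+ 1# (suc m) (suc n)) ⟩
    - (fromℕ (suc m) + fromℕ (suc n)) ≈⟨ -‿+-comm _ _ ⟨
    - fromℕ (suc m) + - fromℕ (suc n) ∎

  fromSign : Sign → Carrier
  fromSign Sign.+ = 1#
  fromSign Sign.- = - 1#

  fromSign-* : ∀ s t → fromSign (s Sign.* t) ≈ fromSign s * fromSign t
  fromSign-* Sign.+ t      = sym (*-identityˡ _)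
  fromSign-* Sign.- Sign.+ = sym (*-identityʳ _)
  fromSign-* Sign.- Sign.- = begin
    1#            ≈⟨ -‿involutive 1# ⟨
    - - 1#        ≈⟨ -‿cong (-1*x≈-x 1#) ⟨
    - (- 1# * 1#) ≈⟨ -‿distribʳ-* (- 1#) 1# ⟩
    - 1# * - 1#   ∎

  fromℤ-◃ : ∀ s n → fromℤ (s ◃ n) ≈ fromSign s * fromℕ n
  fromℤ-◃ s      zero    = sym (zeroʳ _)
  fromℤ-◃ Sign.+ (suc n) = sym (*-identityˡ _)
  fromℤ-◃ Sign.- (suc n) = sym (-1*x≈-x _)

  fromℤ-sign : ∀ i → fromℤ i ≈ fromSign (sign i) * fromℕ ∣ i ∣
  fromℤ-sign (+ n)    = sym (*-identityˡ _)
  fromℤ-sign -[1+ n ] = sym (-1*x≈-x _)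

  fromℤ-* : ∀ i j → fromℤ (i ℤ.* j) ≈ fromℤ i * fromℤ j
  fromℤ-* i j = begin
    fromℤ ((sign i Sign.* sign j) ◃ (∣ i ∣ ℕ.* ∣ j ∣))
      ≈⟨ fromℤ-◃ (sign i Sign.* sign j) (∣ i ∣ ℕ.* ∣ j ∣) ⟩
    fromSign (sign i Sign.* sign j) * fromℕ (∣ i ∣ ℕ.* ∣ j ∣)
      ≈⟨ *-cong (fromSign-* (sign i) (sign j)) (×1-homo-* ∣ i ∣ ∣ j ∣) ⟩
    (fromSign (sign i) * fromSign (sign j)) * (fromℕ ∣ i ∣ * fromℕ ∣ j ∣)
      ≈⟨ *-interchange _ _ _ _ ⟩
    (fromSign (sign i) * fromℕ ∣ i ∣) * (fromSign (sign j) * fromℕ ∣ j ∣)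
      ≈⟨ *-cong (fromℤ-sign i) (fromℤ-sign j) ⟨
    fromℤ i * fromℤ j ∎

  fromℤ-homomorphism : ℤ.+-*-rawRing ACR.-Raw-AlmostCommutative⟶ ACR.fromCommutativeRing R
  fromℤ-homomorphism = record
    { ⟦_⟧    = fromℤ
    ; +-homo = fromℤ-+
    ; *-homo = fromℤ-*
    ; -‿homo = fromℤ-neg
    ; 0-homo = refl
    ; 1-homo = +-identityʳ 1#
    }

  fromℤ-≟ : ∀ i j → Maybe (fromℤ i ≈ fromℤ j)
  fromℤ-≟ i j with i ℤ.≟ j
  ... | yes ≡.refl = just refl
  ... | no _       = nothing

  open Algebra.Solver.Ring ℤ.+-*-rawRing (ACR.fromCommutativeRing R) fromℤ-homomorphism fromℤ-≟ public


module Development {c ℓ : Level} (R : CommutativeRing c ℓ) where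
  open CommutativeRing R
  open PowerSeries R
  open import Algebra.Properties.Ring ring using (-0#≈0#; -‿+-comm)
  open import Algebra.Properties.CommutativeSemigroup +-commutativeSemigroup
    using () renaming (interchange to +-interchange)

  module Solver = IntegerCoefficientSolver R
  module ≈-Reasoning = SetoidReasoning setoid

  sumBelow-cong : ∀ {f g : ℕ → Carrier} n → (∀ i → i < n → f i ≈ g i) →
    sumBelow f n ≈ sumBelow g n
  sumBelow-cong zero    f≈g = refl
  sumBelow-cong (suc n) f≈g =
    +-cong (sumBelow-cong n (λ i i<n → f≈g i (ℕₚ.m<n⇒m<1+n i<n))) (f≈g n ℕₚ.≤-refl)

  sumBelow-distrib-+ : ∀ (f g : ℕ → Carrier) n →
    sumBelow (λ i → f i + g i) n ≈ sumBelow f n + sumBelow g n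
  sumBelow-distrib-+ f g zero    = sym (+-identityˡ 0#)
  sumBelow-distrib-+ f g (suc n) =
    trans (+-congʳ (sumBelow-distrib-+ f g n)) (+-interchange _ _ _ _)

  *-distribˡ-sumBelow : ∀ k (f : ℕ → Carrier) n → k * sumBelow f n ≈ sumBelow (λ i → k * f i) n
  *-distribˡ-sumBelow k f zero    = zeroʳ k
  *-distribˡ-sumBelow k f (suc n) = trans (distribˡ k _ _) (+-congʳ (*-distribˡ-sumBelow k f n))

  -‿distrib-sumBelow : ∀ (f : ℕ → Carrier) n → - sumBelow f n ≈ sumBelow (λ i → - f i) n
  -‿distrib-sumBelow f zero    = -0#≈0#
  -‿distrib-sumBelow f (suc n) =
    trans (sym (-‿+-comm _ _)) (+-congʳ (-‿distrib-sumBelow f n))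

  sumBelow-zero : ∀ (f : ℕ → Carrier) n → (∀ i → i < n → f i ≈ 0#) → sumBelow f n ≈ 0#
  sumBelow-zero f zero    f≈0 = refl
  sumBelow-zero f (suc n) f≈0 =
    trans (+-cong (sumBelow-zero f n (λ i i<n → f≈0 i (ℕₚ.m<n⇒m<1+n i<n))) (f≈0 n ℕₚ.≤-refl))
          (+-identityʳ 0#)

  sumBelow-suc : ∀ (f : ℕ → Carrier) n → sumBelow f (suc n) ≈ f 0 + sumBelow (λ i → f (suc i)) n
  sumBelow-suc f zero    = trans (+-identityˡ _) (sym (+-identityʳ _))
  sumBelow-suc f (suc n) = trans (+-congʳ (sumBelow-suc f n)) (+-assoc _ _ _)

  sumBelow-comm : ∀ (g : ℕ → ℕ → Carrier) m n →
    sumBelow (λ i → sumBelow (g i) n) m ≈ sumBelow (λ j → sumBelow (λ i → g i j) m) n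
  sumBelow-comm g zero    n = sym (sumBelow-zero _ n (λ _ _ → refl))
  sumBelow-comm g (suc m) n =
    trans (+-congʳ (sumBelow-comm g m n)) (sym (sumBelow-distrib-+ _ (g m) n))

  sumBelow-extend : ∀ (f : ℕ → Carrier) {n m} → n ≤ m → (∀ i → n ≤ i → f i ≈ 0#) →
    sumBelow f m ≈ sumBelow f n
  sumBelow-extend f {n} {m} n≤m f≈0 =
    ≡.subst (λ k → sumBelow f k ≈ sumBelow f n) (ℕₚ.m+[n∸m]≡n n≤m) (go (m ∸ n))
    where
    go : ∀ k → sumBelow f (n ℕ.+ k) ≈ sumBelow f n
    go zero    rewrite ℕₚ.+-identityʳ n = refl
    go (suc k) rewrite ℕₚ.+-suc n k =
      trans (+-cong (go k) (f≈0 (n ℕ.+ k) (ℕₚ.m≤m+n n k))) (+-identityʳ _)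

  -- The ring of formal power series

  infix  4 _≋_
  infixl 6 _⊕_
  infix  8 ⊝_

  _≋_ : Series → Series → Set ℓ
  f ≋ g = ∀ N → f N ≈ g N

  _⊕_ : Series → Series → Series
  (f ⊕ g) N = f N + g N

  ⊝_ : Series → Series
  (⊝ f) N = - f N

  zeroS : Series
  zeroS _ = 0#

  scale : Carrier → Series → Series
  scale k f N = k * f N

  tail : Series → Series
  tail f N = f (suc N)

  shift : Series → Series
  shift f zero    = 0#
  shift f (suc N) = f N

  ≋-refl : ∀ {f} → f ≋ f
  ≋-refl N = refl

  ≋-sym : ∀ {f g} → f ≋ g → g ≋ f
  ≋-sym f≋g N = sym (f≋g N)

  ≋-trans : ∀ {f g h} → f ≋ g → g ≋ h → f ≋ h
  ≋-trans f≋g g≋h N = trans (f≋g N) (g≋h N)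

  ⊕-cong : ∀ {f f′ g g′} → f ≋ f′ → g ≋ g′ → f ⊕ g ≋ f′ ⊕ g′
  ⊕-cong f≋f′ g≋g′ N = +-cong (f≋f′ N) (g≋g′ N)

  ⊝-cong : ∀ {f g} → f ≋ g → ⊝ f ≋ ⊝ g
  ⊝-cong f≋g N = -‿cong (f≋g N)

  ⊛-cong-upTo : ∀ {f f′ g g′ : Series} N →
    (∀ i → i ≤ N → f i ≈ f′ i) → (∀ i → i ≤ N → g i ≈ g′ i) →
    (f ⊛ g) N ≈ (f′ ⊛ g′) N
  ⊛-cong-upTo N f≈f′ g≈g′ = sumBelow-cong (suc N) (λ i i<1+N →
    *-cong (f≈f′ i (ℕₚ.≤-pred i<1+N)) (g≈g′ (N ∸ i) (ℕₚ.m∸n≤m N i)))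

  ⊛-cong : ∀ {f f′ g g′ : Series} → f ≋ f′ → g ≋ g′ → (f ⊛ g) ≋ (f′ ⊛ g′)
  ⊛-cong f≋f′ g≋g′ N = ⊛-cong-upTo N (λ i _ → f≋f′ i) (λ i _ → g≋g′ i)

  ⊛-congˡ : ∀ {f f′ : Series} g → f ≋ f′ → (f ⊛ g) ≋ (f′ ⊛ g)
  ⊛-congˡ g f≋f′ = ⊛-cong f≋f′ (≋-refl {g})

  ⊛-congʳ : ∀ f {g g′ : Series} → g ≋ g′ → (f ⊛ g) ≋ (f ⊛ g′)
  ⊛-congʳ f g≋g′ = ⊛-cong (≋-refl {f}) g≋g′

  ⊛-suc-tailˡ : ∀ (f g : Series) N → (f ⊛ g) (suc N) ≈ f 0 * g (suc N) + (tail f ⊛ g) N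
  ⊛-suc-tailˡ f g N = sumBelow-suc (λ i → f i * g (suc N ∸ i)) (suc N)

  ⊛-suc-tailʳ : ∀ (f g : Series) N → (f ⊛ g) (suc N) ≈ (f ⊛ tail g) N + f (suc N) * g 0
  ⊛-suc-tailʳ f g N =
    +-cong (sumBelow-cong (suc N) (λ i i<1+N →
              *-congˡ (reflexive (≡.cong g (ℕₚ.+-∸-assoc 1 (ℕₚ.≤-pred i<1+N))))))
           (*-congˡ (reflexive (≡.cong g (ℕₚ.n∸n≡0 N))))

  ⊛-comm : ∀ (f g : Series) → (f ⊛ g) ≋ (g ⊛ f)
  ⊛-comm f g zero    = +-congˡ (*-comm _ _)
  ⊛-comm f g (suc N) = begin
    (f ⊛ g) (suc N)                  ≈⟨ ⊛-suc-tailˡ f g N ⟩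
    f 0 * g (suc N) + (tail f ⊛ g) N ≈⟨ +-cong (*-comm _ _) (⊛-comm (tail f) g N) ⟩
    g (suc N) * f 0 + (g ⊛ tail f) N ≈⟨ +-comm _ _ ⟩
    (g ⊛ tail f) N + g (suc N) * f 0 ≈⟨ ⊛-suc-tailʳ g f N ⟨
    (g ⊛ f) (suc N)                  ∎
    where open ≈-Reasoning

  ⊛-distribʳ : ∀ (h f g : Series) → ((f ⊕ g) ⊛ h) ≋ (f ⊛ h) ⊕ (g ⊛ h)
  ⊛-distribʳ h f g N =
    trans (sumBelow-cong (suc N) (λ i _ → distribʳ _ _ _)) (sumBelow-distrib-+ _ _ (suc N))

  ⊛-distribˡ : ∀ (h f g : Series) → (h ⊛ (f ⊕ g)) ≋ (h ⊛ f) ⊕ (h ⊛ g)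
  ⊛-distribˡ h f g N =
    trans (sumBelow-cong (suc N) (λ i _ → distribˡ _ _ _)) (sumBelow-distrib-+ _ _ (suc N))

  scale-⊛ : ∀ k (f g : Series) → (scale k f ⊛ g) ≋ scale k (f ⊛ g)
  scale-⊛ k f g N =
    trans (sumBelow-cong (suc N) (λ i _ → *-assoc _ _ _)) (sym (*-distribˡ-sumBelow k _ (suc N)))

  ⊛-zeroˡ : ∀ (g : Series) → (zeroS ⊛ g) ≋ zeroS
  ⊛-zeroˡ g N = sumBelow-zero _ (suc N) (λ i _ → zeroˡ _)

  ⊛-identityˡ : ∀ (g : Series) → (oneS ⊛ g) ≋ g
  ⊛-identityˡ g zero    = trans (+-identityˡ _) (*-identityˡ _)
  ⊛-identityˡ g (suc N) =
    trans (⊛-suc-tailˡ oneS g N) (trans (+-cong (*-identityˡ _) (⊛-zeroˡ g N)) (+-identityʳ _))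

  ⊛-identityʳ : ∀ (f : Series) → (f ⊛ oneS) ≋ f
  ⊛-identityʳ f = ≋-trans (⊛-comm f oneS) (⊛-identityˡ f)

  shift-⊛ : ∀ (f g : Series) → (shift f ⊛ g) ≋ shift (f ⊛ g)
  shift-⊛ f g zero    = trans (+-identityˡ _) (zeroˡ _)
  shift-⊛ f g (suc N) = trans (⊛-suc-tailˡ (shift f) g N) (trans (+-congʳ (zeroˡ _)) (+-identityˡ _))

  ⊛-assoc : ∀ (f g h : Series) → ((f ⊛ g) ⊛ h) ≋ (f ⊛ (g ⊛ h))
  ⊛-assoc f g h zero    =
    trans (+-identityˡ _) (trans (*-congʳ (+-identityˡ _))
      (trans (*-assoc _ _ _) (sym (trans (+-identityˡ _) (*-congˡ (+-identityˡ _))))))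
  ⊛-assoc f g h (suc N) = begin
    ((f ⊛ g) ⊛ h) (suc N)
      ≈⟨ ⊛-suc-tailˡ (f ⊛ g) h N ⟩
    (f ⊛ g) 0 * h (suc N) + (tail (f ⊛ g) ⊛ h) N
      ≈⟨ +-cong (*-congʳ (+-identityˡ _)) (⊛-congˡ h (⊛-suc-tailˡ f g) N) ⟩
    (f 0 * g 0) * h (suc N) + ((scale (f 0) (tail g) ⊕ (tail f ⊛ g)) ⊛ h) N
      ≈⟨ +-congˡ (trans (⊛-distribʳ h _ _ N) (+-congʳ (scale-⊛ (f 0) (tail g) h N))) ⟩
    (f 0 * g 0) * h (suc N) + (f 0 * (tail g ⊛ h) N + ((tail f ⊛ g) ⊛ h) N)
      ≈⟨ +-congˡ (+-congˡ (⊛-assoc (tail f) g h N)) ⟩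
    (f 0 * g 0) * h (suc N) + (f 0 * (tail g ⊛ h) N + (tail f ⊛ (g ⊛ h)) N)
      ≈⟨ Solver.solve 5 (λ a b c d e → (a :* b) :* c :+ (a :* d :+ e) := a :* (b :* c :+ d) :+ e)
           refl _ _ _ _ _ ⟩
    f 0 * (g 0 * h (suc N) + (tail g ⊛ h) N) + (tail f ⊛ (g ⊛ h)) N
      ≈⟨ +-congʳ (*-congˡ (⊛-suc-tailˡ g h N)) ⟨
    f 0 * (g ⊛ h) (suc N) + (tail f ⊛ (g ⊛ h)) N
      ≈⟨ ⊛-suc-tailˡ f (g ⊛ h) N ⟨
    (f ⊛ (g ⊛ h)) (suc N) ∎
    where
    open ≈-Reasoning
    open Solver using (_:+_; _:*_; _:=_)

  seriesRing : CommutativeRing c ℓ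
  seriesRing = record
    { Carrier = Series
    ; _≈_ = _≋_
    ; _+_ = _⊕_
    ; _*_ = _⊛_
    ; -_ = ⊝_
    ; 0# = zeroS
    ; 1# = oneS
    ; isCommutativeRing = record
      { isRing = record
        { +-isAbelianGroup = record
          { isGroup = record
            { isMonoid = record
              { isSemigroup = record
                { isMagma = record
                  { isEquivalence = record { refl = ≋-refl ; sym = ≋-sym ; trans = ≋-trans }
                  ; ∙-cong = ⊕-cong }
                ; assoc = λ f g h N → +-assoc _ _ _ }
              ; identity = (λ f N → +-identityˡ _) , (λ f N → +-identityʳ _) }
            ; inverse = (λ f N → -‿inverseˡ _) , (λ f N → -‿inverseʳ _)
            ; ⁻¹-cong = ⊝-cong }
          ; comm = λ f g N → +-comm _ _ }
        ; *-cong = ⊛-cong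
        ; *-assoc = ⊛-assoc
        ; *-identity = ⊛-identityˡ , ⊛-identityʳ
        ; distrib = ⊛-distribˡ , ⊛-distribʳ }
      ; *-comm = ⊛-comm } }

  module SeriesSolver = IntegerCoefficientSolver seriesRing
  module ≋-Reasoning = SetoidReasoning (CommutativeRing.setoid seriesRing)

  shiftBy : ℕ → Series → Series
  shiftBy zero    f = f
  shiftBy (suc k) f = shift (shiftBy k f)

  shift-cong : ∀ {f g} → f ≋ g → shift f ≋ shift g
  shift-cong f≋g zero    = refl
  shift-cong f≋g (suc N) = f≋g N

  shiftBy-cong : ∀ k {f g} → f ≋ g → shiftBy k f ≋ shiftBy k g
  shiftBy-cong zero    f≋g = f≋g
  shiftBy-cong (suc k) f≋g = shift-cong (shiftBy-cong k f≋g)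

  shiftBy-scale : ∀ k b f → shiftBy k (scale b f) ≋ scale b (shiftBy k f)
  shiftBy-scale zero    b f = ≋-refl
  shiftBy-scale (suc k) b f = ≋-trans (shift-cong (shiftBy-scale k b f)) shift-scale
    where
    shift-scale : shift (scale b (shiftBy k f)) ≋ scale b (shift (shiftBy k f))
    shift-scale zero    = sym (zeroʳ b)
    shift-scale (suc N) = refl

  shiftBy-+ : ∀ i j f → shiftBy i (shiftBy j f) ≋ shiftBy (i ℕ.+ j) f
  shiftBy-+ zero    j f = ≋-refl
  shiftBy-+ (suc i) j f = shift-cong (shiftBy-+ i j f)

  shiftBy-low : ∀ k f {N} → N < k → shiftBy k f N ≈ 0#
  shiftBy-low (suc k) f {zero}  _         = refl
  shiftBy-low (suc k) f {suc N} (s≤s N<k) = shiftBy-low k f N<k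

  mono-⊛ : ∀ b k g → (mono b k ⊛ g) ≋ shiftBy k (scale b g)
  mono-⊛ b zero g =
    ≋-trans (⊛-congˡ g mono-zero) (≋-trans (scale-⊛ b oneS g) (λ N → *-congˡ (⊛-identityˡ g N)))
    where
    mono-zero : mono b 0 ≋ scale b oneS
    mono-zero zero    = sym (*-identityʳ b)
    mono-zero (suc N) = sym (zeroʳ b)
  mono-⊛ b (suc k) g =
    ≋-trans (⊛-congˡ g mono-suc) (≋-trans (shift-⊛ (mono b k) g) (shift-cong (mono-⊛ b k g)))
    where
    mono-suc : mono b (suc k) ≋ shift (mono b k)
    mono-suc zero    = refl
    mono-suc (suc N) = refl

  mono≋shiftBy : ∀ b k → mono b k ≋ shiftBy k (scale b oneS)
  mono≋shiftBy b k = ≋-trans (≋-sym (⊛-identityʳ (mono b k))) (mono-⊛ b k oneS)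

  mono-cong : ∀ {a b} k → a ≈ b → mono a k ≋ mono b k
  mono-cong k a≈b =
    ≋-trans (mono≋shiftBy _ k)
      (≋-trans (shiftBy-cong k (λ N → *-congʳ a≈b)) (≋-sym (mono≋shiftBy _ k)))

  mono-congᵉ : ∀ a {i j} → i ≡ j → mono a i ≋ mono a j
  mono-congᵉ a ≡.refl = ≋-refl

  mono-⊛-mono : ∀ a b i j → (mono a i ⊛ mono b j) ≋ mono (a * b) (i ℕ.+ j)
  mono-⊛-mono a b i j = ≋-trans (mono-⊛ a i (mono b j)) (≋-trans (shiftBy-cong i scale-mono)
    (≋-trans (shiftBy-+ i j _) (≋-sym (mono≋shiftBy (a * b) (i ℕ.+ j)))))
    where
    scale-mono : scale a (mono b j) ≋ shiftBy j (scale (a * b) oneS)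
    scale-mono = ≋-trans (λ N → *-congˡ (mono≋shiftBy b j N))
      (≋-trans (≋-sym (shiftBy-scale j a (scale b oneS))) (shiftBy-cong j (λ N → sym (*-assoc _ _ _))))

  mono-⊛-mono-≋ : ∀ {a b c d} i j k l → a * b ≈ c * d → i ℕ.+ j ≡ k ℕ.+ l →
    (mono a i ⊛ mono b j) ≋ (mono c k ⊛ mono d l)
  mono-⊛-mono-≋ i j k l ab≈cd i+j≡k+l = ≋-trans (mono-⊛-mono _ _ i j)
    (≋-trans (mono-cong _ ab≈cd) (≋-trans (mono-congᵉ _ i+j≡k+l) (≋-sym (mono-⊛-mono _ _ k l))))

  ⊛-mono-low : ∀ b k g {N} → N < k → (g ⊛ mono b k) N ≈ 0#
  ⊛-mono-low b k g {N} N<k = trans (⊛-comm g (mono b k) N) (trans (mono-⊛ b k g N) (shiftBy-low k _ N<k))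

  mono-low : ∀ b {i k} → i < k → mono b k i ≈ 0#
  mono-low b {zero}  {suc k} _         = refl
  mono-low b {suc i} {suc k} (s≤s i<k) = mono-low b i<k

  -- q-Pochhammer symbols and reciprocals

  ⊛-oneMinus-low : ∀ f x k {j} → j < k → (f ⊛ oneMinus x k) j ≈ f j
  ⊛-oneMinus-low f x k {j} j<k = trans (⊛-comm f (oneMinus x k) j)
    (trans (⊛-cong-upTo {g = f} j oneMinus-low (λ _ _ → refl)) (⊛-identityˡ f j))
    where
    oneMinus-low : ∀ i → i ≤ j → oneMinus x k i ≈ oneS i
    oneMinus-low i i≤j =
      trans (+-congˡ (trans (-‿cong (mono-low x (ℕₚ.≤-<-trans i≤j j<k))) -0#≈0#)) (+-identityʳ _)

  poch-low : ∀ x k n {j} → j < k → poch x k n j ≈ oneS j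
  poch-low x k zero    j<k = refl
  poch-low x k (suc n) j<k =
    trans (⊛-oneMinus-low (poch x k n) x (k ℕ.+ n) (ℕₚ.<-≤-trans j<k (ℕₚ.m≤m+n k n)))
          (poch-low x k n j<k)

  poch-extend : ∀ x s n m {j} → j < s ℕ.+ n → poch x s n j ≈ poch x s (n ℕ.+ m) j
  poch-extend x s n zero    j<s+n rewrite ℕₚ.+-identityʳ n = refl
  poch-extend x s n (suc m) j<s+n rewrite ℕₚ.+-suc n m =
    trans (poch-extend x s n m j<s+n) (sym (⊛-oneMinus-low (poch x s (n ℕ.+ m)) x (s ℕ.+ (n ℕ.+ m))
      (ℕₚ.<-≤-trans j<s+n (ℕₚ.+-monoʳ-≤ s (ℕₚ.m≤m+n n m)))))

  poch-stable : ∀ x s n m {j} → j < s ℕ.+ n → j < s ℕ.+ m → poch x s n j ≈ poch x s m j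
  poch-stable x s n m {j} j<s+n j<s+m with ℕₚ.≤-total n m
  ... | inj₁ n≤m = trans (poch-extend x s n (m ∸ n) j<s+n)
                         (reflexive (≡.cong (λ k → poch x s k j) (ℕₚ.m+[n∸m]≡n n≤m)))
  ... | inj₂ m≤n = sym (trans (poch-extend x s m (n ∸ m) j<s+m)
                              (reflexive (≡.cong (λ k → poch x s k j) (ℕₚ.m+[n∸m]≡n m≤n))))

  poch-suc-head : ∀ x s n → poch x s (suc n) ≋ (oneMinus x s ⊛ poch x (suc s) n)
  poch-suc-head x s zero rewrite ℕₚ.+-identityʳ s = ⊛-comm oneS (oneMinus x s)
  poch-suc-head x s (suc n) =
    ≋-trans (⊛-congˡ (oneMinus x (s ℕ.+ suc n)) (poch-suc-head x s n))
      (≋-trans (⊛-assoc (oneMinus x s) (poch x (suc s) n) (oneMinus x (s ℕ.+ suc n)))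
        (⊛-congʳ (oneMinus x s) (λ N →
          reflexive (≡.cong (λ k → (poch x (suc s) n ⊛ oneMinus x k) N) (ℕₚ.+-suc s n)))))

  pochInf-suc : ∀ x t → pochInf x t ≋ (oneMinus x t ⊛ pochInf x (suc t))
  pochInf-suc x t N = trans (poch-suc-head x t N N) (⊛-cong-upTo {f = oneMinus x t} N (λ _ _ → refl)
    (λ j j≤N → poch-stable x (suc t) N (suc j)
      (s≤s (ℕₚ.≤-trans j≤N (ℕₚ.m≤n+m N t)))
      (s≤s (ℕₚ.≤-trans (ℕₚ.n≤1+n j) (ℕₚ.m≤n+m (suc j) t)))))

  sumL-zipWith-invRev : ∀ (f : Series) N (h : ℕ → ℕ) (g : ℕ → Carrier) →
    sumL (zipWith _*_ (map g (applyUpTo h (suc N))) (invRev f N))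
      ≈ sumBelow (λ j → g (h j) * inv f (N ∸ j)) (suc N)
  sumL-zipWith-invRev f zero    h g = trans (+-identityʳ _) (sym (+-identityˡ _))
  sumL-zipWith-invRev f (suc N) h g = trans (+-congˡ (sumL-zipWith-invRev f N (λ k → h (suc k)) g))
    (sym (sumBelow-suc (λ j → g (h j) * inv f (suc N ∸ j)) (suc N)))

  inv-inverseʳ : ∀ (f : Series) → f 0 ≈ 1# → (f ⊛ inv f) ≋ oneS
  inv-inverseʳ f f0≈1 zero    = trans (+-identityˡ _) (trans (*-congʳ f0≈1) (*-identityˡ _))
  inv-inverseʳ f f0≈1 (suc N) = begin
    (f ⊛ inv f) (suc N)                      ≈⟨ ⊛-suc-tailˡ f (inv f) N ⟩
    f 0 * inv f (suc N) + (tail f ⊛ inv f) N ≈⟨ +-congʳ (*-cong f0≈1 inv-suc) ⟩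
    1# * - (tail f ⊛ inv f) N + (tail f ⊛ inv f) N ≈⟨ +-congʳ (*-identityˡ _) ⟩
    - (tail f ⊛ inv f) N + (tail f ⊛ inv f) N     ≈⟨ -‿inverseˡ _ ⟩
    0#                                            ∎
    where
    open ≈-Reasoning
    inv-suc : inv f (suc N) ≈ - (tail f ⊛ inv f) N
    inv-suc = -‿cong (sumL-zipWith-invRev f N (λ k → k) (λ j → f (suc j)))

  inv-⊛ : ∀ (f g : Series) → f 0 ≈ 1# → (f ⊛ g) 0 ≈ 1# → inv f ≋ (g ⊛ inv (f ⊛ g))
  inv-⊛ f g f0≈1 fg0≈1 = begin
    inv f                             ≈⟨ ⊛-identityʳ (inv f) ⟨
    inv f ⊛ oneS                      ≈⟨ ⊛-congʳ (inv f) (inv-inverseʳ (f ⊛ g) fg0≈1) ⟨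
    inv f ⊛ ((f ⊛ g) ⊛ inv (f ⊛ g))   ≈⟨ SeriesSolver.solve 4
                                           (λ i f g j → i :* ((f :* g) :* j) := (f :* i) :* (g :* j))
                                           ≋-refl (inv f) f g (inv (f ⊛ g)) ⟩
    (f ⊛ inv f) ⊛ (g ⊛ inv (f ⊛ g))   ≈⟨ ⊛-congˡ (g ⊛ inv (f ⊛ g)) (inv-inverseʳ f f0≈1) ⟩
    oneS ⊛ (g ⊛ inv (f ⊛ g))          ≈⟨ ⊛-identityˡ _ ⟩
    g ⊛ inv (f ⊛ g)                   ∎
    where
    open ≋-Reasoning
    open SeriesSolver using (_:*_; _:=_)

  -- Under this condition the truncation in sumSeries is harmless: sumSeries t is the q-adic sum of t.
  OrderAtLeastIndex : (ℕ → Series) → Set ℓ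
  OrderAtLeastIndex t = ∀ n N → N < n → t n N ≈ 0#

  OrderAtLeastIndex-⊛ : ∀ (f t : ℕ → Series) → OrderAtLeastIndex t →
    OrderAtLeastIndex (λ n → f n ⊛ t n)
  OrderAtLeastIndex-⊛ f t ord n N N<n = sumBelow-zero _ (suc N) (λ i _ →
    trans (*-congˡ (ord n (N ∸ i) (ℕₚ.≤-<-trans (ℕₚ.m∸n≤m N i) N<n))) (zeroʳ _))

  OrderAtLeastIndex-⊛-mono : ∀ (f : ℕ → Series) (b : ℕ → Carrier) (k : ℕ → ℕ) →
    (∀ n → n ≤ k n) → OrderAtLeastIndex (λ n → f n ⊛ mono (b n) (k n))
  OrderAtLeastIndex-⊛-mono f b k n≤k n N N<n = ⊛-mono-low (b n) (k n) (f n) (ℕₚ.<-≤-trans N<n (n≤k n))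

  sumSeries-cong : ∀ {t u} → (∀ n → t n ≋ u n) → sumSeries t ≋ sumSeries u
  sumSeries-cong t≋u N = sumBelow-cong (suc N) (λ n _ → t≋u n N)

  sumSeries-⊕ : ∀ t u → sumSeries (λ n → t n ⊕ u n) ≋ sumSeries t ⊕ sumSeries u
  sumSeries-⊕ t u N = sumBelow-distrib-+ (λ n → t n N) (λ n → u n N) (suc N)

  sumSeries-⊝ : ∀ t → sumSeries (λ n → ⊝ t n) ≋ ⊝ sumSeries t
  sumSeries-⊝ t N = sym (-‿distrib-sumBelow (λ n → t n N) (suc N))

  sumSeries-suc : ∀ t → OrderAtLeastIndex t → sumSeries t ≋ t 0 ⊕ sumSeries (λ n → t (suc n))
  sumSeries-suc t ord N = trans (sumBelow-suc (λ n → t n N) N)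
    (+-congˡ (sym (trans (+-congˡ (ord (suc N) N ℕₚ.≤-refl)) (+-identityʳ _))))

  ⊛-sumSeries : ∀ f t → OrderAtLeastIndex t → (f ⊛ sumSeries t) ≋ sumSeries (λ n → f ⊛ t n)
  ⊛-sumSeries f t ord N = begin
    sumBelow (λ i → f i * sumSeries t (N ∸ i)) (suc N)
      ≈⟨ sumBelow-cong (suc N) (λ i i<1+N → *-congˡ (sym (sumBelow-extend (λ n → t n (N ∸ i))
           (s≤s (ℕₚ.m∸n≤m N i)) (λ n N-i<n → ord n (N ∸ i) N-i<n)))) ⟩
    sumBelow (λ i → f i * sumBelow (λ n → t n (N ∸ i)) (suc N)) (suc N)
      ≈⟨ sumBelow-cong (suc N) (λ i _ → *-distribˡ-sumBelow (f i) _ (suc N)) ⟩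
    sumBelow (λ i → sumBelow (λ n → f i * t n (N ∸ i)) (suc N)) (suc N)
      ≈⟨ sumBelow-comm (λ i n → f i * t n (N ∸ i)) (suc N) (suc N) ⟩
    sumBelow (λ n → sumBelow (λ i → f i * t n (N ∸ i)) (suc N)) (suc N) ∎
    where open ≈-Reasoning

  -- The family Φ_s and its recurrence

  tri-suc : ∀ n → tri (suc n) ≡ tri n ℕ.+ suc n
  tri-suc n = ≡.trans (≡.cong (_/ 2) n+1[n+2]≡n[n+1]+[n+1]2)
    (≡.trans (+-distrib-/-∣ʳ (n ℕ.* suc n) (n∣m*n (suc n))) (≡.cong (tri n ℕ.+_) (m*n/n≡m (suc n) 2)))
    where
    open +-*-Solver
    n+1[n+2]≡n[n+1]+[n+1]2 : suc n ℕ.* suc (suc n) ≡ n ℕ.* suc n ℕ.+ suc n ℕ.* 2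
    n+1[n+2]≡n[n+1]+[n+1]2 =
      solve 1 (λ n → (con 1 :+ n) :* (con 2 :+ n) := n :* (con 1 :+ n) :+ (con 1 :+ n) :* con 2) ≡.refl n

  n≤tri : ∀ n → n ≤ tri n
  n≤tri zero    = z≤n
  n≤tri (suc n) rewrite tri-suc n = ℕₚ.m≤n+m (suc n) (tri n)

  recurrenceFactor : Carrier → Carrier → ℕ → Series
  recurrenceFactor A B s = mono A (suc (suc (suc (s ℕ.+ s)))) ⊕ ⊝ mono B (suc s)

  module Family (x z : Carrier) where
    P : ℕ → Series
    P n = poch x 0 n

    E : ℕ → Series
    E t = pochInf z t

    I : ℕ → Series
    I n = inv (poch 1# 1 n)

    Q : ℕ → ℕ → Series
    Q s n = mono (pow z n) (s ℕ.* n ℕ.+ tri n)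

    term : ℕ → ℕ → Series
    term s n = ((P n ⊛ E (suc (s ℕ.+ n))) ⊛ I n) ⊛ Q s n

    term′ : ℕ → ℕ → Series
    term′ s n = ((P n ⊛ E (suc (suc (s ℕ.+ n)))) ⊛ I n) ⊛ Q s n

    Φ : ℕ → Series
    Φ s = sumSeries (term s)

    I-suc : ∀ n → I n ≋ (oneMinus 1# (suc n) ⊛ I (suc n))
    I-suc n = inv-⊛ (poch 1# 1 n) (oneMinus 1# (suc n))
      (poch-low 1# 1 n (s≤s z≤n)) (poch-low 1# 1 (suc n) (s≤s z≤n))

    Q-+ : ∀ k s n → Q (k ℕ.+ s) n ≋ (mono 1# (k ℕ.* n) ⊛ Q s n)
    Q-+ k s n = ≋-sym (≋-trans (mono-⊛-mono 1# (pow z n) (k ℕ.* n) (s ℕ.* n ℕ.+ tri n))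
      (≋-trans (mono-cong _ (*-identityˡ _)) (mono-congᵉ _ exponent)))
      where
      open +-*-Solver
      exponent : k ℕ.* n ℕ.+ (s ℕ.* n ℕ.+ tri n) ≡ (k ℕ.+ s) ℕ.* n ℕ.+ tri n
      exponent = solve 4 (λ k s n t → k :* n :+ (s :* n :+ t) := (k :+ s) :* n :+ t) ≡.refl k s n (tri n)

    Q-suc : ∀ s n → Q s (suc n) ≋ (mono z (suc (s ℕ.+ n)) ⊛ Q s n)
    Q-suc s n = ≋-sym (≋-trans (mono-⊛-mono z (pow z n) (suc (s ℕ.+ n)) (s ℕ.* n ℕ.+ tri n))
      (mono-congᵉ _ exponent))
      where
      open +-*-Solver
      exponent : suc (s ℕ.+ n) ℕ.+ (s ℕ.* n ℕ.+ tri n) ≡ s ℕ.* suc n ℕ.+ tri (suc n)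
      exponent rewrite tri-suc n =
        solve 3 (λ s n t → (con 1 :+ (s :+ n)) :+ (s :* n :+ t) := s :* (con 1 :+ n) :+ (t :+ (con 1 :+ n)))
          ≡.refl s n (tri n)

    n≤exponent : ∀ s n → n ≤ s ℕ.* n ℕ.+ tri n
    n≤exponent s n = ℕₚ.≤-trans (n≤tri n) (ℕₚ.m≤n+m (tri n) (s ℕ.* n))

    term-order : ∀ s → OrderAtLeastIndex (term s)
    term-order s = OrderAtLeastIndex-⊛-mono _ (pow z) _ (n≤exponent s)

    term′-order : ∀ s → OrderAtLeastIndex (term′ s)
    term′-order s = OrderAtLeastIndex-⊛-mono _ (pow z) _ (n≤exponent s)

    term-difference : ∀ s n →
      term s n ⊕ ⊝ term (suc s) n
        ≋ (oneMinus 1# n ⊛ term′ s n) ⊕ ⊝ (mono z (suc (s ℕ.+ n)) ⊛ term′ s n)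
    term-difference s n = begin
      term s n ⊕ ⊝ term (suc s) n
        ≈⟨ ⊕-cong (⊛-congˡ (Q s n) (⊛-congˡ (I n) (⊛-congʳ (P n) (pochInf-suc z (suc (s ℕ.+ n))))))
                  (⊝-cong (⊛-congʳ ((P n ⊛ E₂) ⊛ I n) Q-suc-s)) ⟩
      (((P n ⊛ (oneMinus z (suc (s ℕ.+ n)) ⊛ E₂)) ⊛ I n) ⊛ Q s n)
        ⊕ ⊝ (((P n ⊛ E₂) ⊛ I n) ⊛ (mono 1# n ⊛ Q s n))
        ≈⟨ SeriesSolver.solve 7 (λ o p e i q mz m →
             (((p :* ((o :- mz) :* e)) :* i) :* q) :- (((p :* e) :* i) :* (m :* q))
               := ((o :- m) :* (((p :* e) :* i) :* q)) :- (mz :* (((p :* e) :* i) :* q)))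
             ≋-refl oneS (P n) E₂ (I n) (Q s n) (mono z (suc (s ℕ.+ n))) (mono 1# n) ⟩
      (oneMinus 1# n ⊛ term′ s n) ⊕ ⊝ (mono z (suc (s ℕ.+ n)) ⊛ term′ s n) ∎
      where
      open ≋-Reasoning
      open SeriesSolver using (_:+_; _:-_; _:*_; _:=_)
      E₂ : Series
      E₂ = E (suc (suc (s ℕ.+ n)))
      Q-suc-s : Q (suc s) n ≋ (mono 1# n ⊛ Q s n)
      Q-suc-s = ≋-trans (Q-+ 1 s n) (⊛-congˡ (Q s n) (mono-congᵉ 1# (ℕₚ.*-identityˡ n)))

    zz-exponent : ∀ s n →
      suc (s ℕ.+ n) ℕ.+ suc (suc (s ℕ.+ n)) ≡ suc (suc (suc (s ℕ.+ s))) ℕ.+ 2 ℕ.* n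
    zz-exponent = solve 2 (λ s n → (con 1 :+ (s :+ n)) :+ (con 2 :+ (s :+ n)) := (con 3 :+ (s :+ s)) :+ con 2 :* n)
      ≡.refl
      where open +-*-Solver

    xz-exponent : ∀ s n → n ℕ.+ suc (s ℕ.+ n) ≡ suc s ℕ.+ 2 ℕ.* n
    xz-exponent = solve 2 (λ s n → n :+ (con 1 :+ (s :+ n)) := (con 1 :+ s) :+ con 2 :* n) ≡.refl
      where open +-*-Solver

    term′-recombination : ∀ s n →
      (oneMinus 1# (suc n) ⊛ term′ s (suc n)) ⊕ ⊝ (mono z (suc (s ℕ.+ n)) ⊛ term′ s n)
        ≋ (recurrenceFactor (z * z) (x * z) s ⊛ term (suc (suc s)) n)
    term′-recombination s n = begin
      (u ⊛ term′ s (suc n)) ⊕ ⊝ (mz ⊛ term′ s n)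
        ≈⟨ ⊕-cong (⊛-congʳ u (⊛-cong (⊛-congˡ (I (suc n)) (⊛-congʳ (P (suc n)) E-index))
                                     (Q-suc s n)))
                  (⊝-cong (⊛-congʳ mz (⊛-congˡ (Q s n)
                    (⊛-cong (⊛-congʳ (P n) (pochInf-suc z (suc (suc (s ℕ.+ n))))) (I-suc n))))) ⟩
      (u ⊛ ((((P n ⊛ oneMinus x n) ⊛ E₃) ⊛ I (suc n)) ⊛ (mz ⊛ Q s n)))
        ⊕ ⊝ (mz ⊛ (((P n ⊛ (oneMinus z (suc (suc (s ℕ.+ n))) ⊛ E₃)) ⊛ (u ⊛ I (suc n))) ⊛ Q s n))
        -- the two summands differ only in the factors (1 − xq^n) and (1 − zq^{s+n+2})
        ≈⟨ SeriesSolver.solve 9 (λ o p mx e j mz q u mz₂ →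
             (u :* ((((p :* (o :- mx)) :* e) :* j) :* (mz :* q)))
               :- (mz :* (((p :* ((o :- mz₂) :* e)) :* (u :* j)) :* q))
               := ((mz :* mz₂) :- (mx :* mz)) :* (((p :* e) :* (u :* j)) :* q))
             ≋-refl oneS (P n) (mono x n) E₃ (I (suc n)) mz (Q s n) u (mono z (suc (suc (s ℕ.+ n)))) ⟩
      ((mz ⊛ mono z (suc (suc (s ℕ.+ n)))) ⊕ ⊝ (mono x n ⊛ mz)) ⊛ rest
        ≈⟨ ⊛-congˡ rest (⊕-cong
             (mono-⊛-mono-≋ _ _ _ (2 ℕ.* n) (sym (*-identityʳ _)) (zz-exponent s n))
             (⊝-cong (mono-⊛-mono-≋ _ _ _ (2 ℕ.* n) (sym (*-identityʳ _)) (xz-exponent s n)))) ⟩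
      ((mzz ⊛ q²ⁿ) ⊕ ⊝ (mxz ⊛ q²ⁿ)) ⊛ rest
        ≈⟨ SeriesSolver.solve 6 (λ a b m pe uj q →
             ((a :* m) :- (b :* m)) :* ((pe :* uj) :* q) := (a :- b) :* ((pe :* uj) :* (m :* q)))
             ≋-refl mzz mxz q²ⁿ (P n ⊛ E₃) (u ⊛ I (suc n)) (Q s n) ⟩
      (mzz ⊕ ⊝ mxz) ⊛ (((P n ⊛ E₃) ⊛ (u ⊛ I (suc n))) ⊛ (q²ⁿ ⊛ Q s n))
        ≈⟨ ⊛-congʳ (mzz ⊕ ⊝ mxz)
             (⊛-cong (⊛-congʳ (P n ⊛ E₃) (≋-sym (I-suc n))) (≋-sym (Q-+ 2 s n))) ⟩
      recurrenceFactor (z * z) (x * z) s ⊛ term (suc (suc s)) n ∎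
      where
      open ≋-Reasoning
      open SeriesSolver using (_:+_; _:-_; _:*_; _:=_)
      u mz mzz mxz q²ⁿ E₃ rest : Series
      u = oneMinus 1# (suc n)
      mz = mono z (suc (s ℕ.+ n))
      mzz = mono (z * z) (suc (suc (suc (s ℕ.+ s))))
      mxz = mono (x * z) (suc s)
      q²ⁿ = mono 1# (2 ℕ.* n)
      E₃ = E (suc (suc (suc (s ℕ.+ n))))
      rest = ((P n ⊛ E₃) ⊛ (u ⊛ I (suc n))) ⊛ Q s n
      E-index : E (suc (suc (s ℕ.+ suc n))) ≋ E₃
      E-index N = reflexive (≡.cong (λ k → E (suc (suc k)) N) (ℕₚ.+-suc s n))

    Φ-difference : ∀ s → Φ s ⊕ ⊝ Φ (suc s) ≋ (recurrenceFactor (z * z) (x * z) s ⊛ Φ (suc (suc s)))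
    Φ-difference s = begin
      Φ s ⊕ ⊝ Φ (suc s)
        ≈⟨ ⊕-cong (≋-refl {Φ s}) (sumSeries-⊝ (term (suc s))) ⟨
      Φ s ⊕ sumSeries (λ n → ⊝ term (suc s) n)
        ≈⟨ sumSeries-⊕ (term s) (λ n → ⊝ term (suc s) n) ⟨
      sumSeries (λ n → term s n ⊕ ⊝ term (suc s) n)
        ≈⟨ sumSeries-cong (term-difference s) ⟩
      sumSeries (λ n → A n ⊕ B n)
        ≈⟨ sumSeries-⊕ A B ⟩
      sumSeries A ⊕ sumSeries B
        ≈⟨ ⊕-cong (sumSeries-suc A A-order) (≋-refl {sumSeries B}) ⟩
      (A 0 ⊕ sumSeries (λ n → A (suc n))) ⊕ sumSeries B
        ≈⟨ ⊕-cong (λ N → trans (+-congʳ (A-zero N)) (+-identityˡ _)) (≋-refl {sumSeries B}) ⟩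
      sumSeries (λ n → A (suc n)) ⊕ sumSeries B
        ≈⟨ sumSeries-⊕ (λ n → A (suc n)) B ⟨
      sumSeries (λ n → A (suc n) ⊕ B n)
        ≈⟨ sumSeries-cong (term′-recombination s) ⟩
      sumSeries (λ n → recurrenceFactor (z * z) (x * z) s ⊛ term (suc (suc s)) n)
        ≈⟨ ⊛-sumSeries _ (term (suc (suc s))) (term-order (suc (suc s))) ⟨
      recurrenceFactor (z * z) (x * z) s ⊛ Φ (suc (suc s)) ∎
      where
      open ≋-Reasoning
      A B : ℕ → Series
      A n = oneMinus 1# n ⊛ term′ s n
      B n = ⊝ (mono z (suc (s ℕ.+ n)) ⊛ term′ s n)
      A-order : OrderAtLeastIndex A
      A-order = OrderAtLeastIndex-⊛ (oneMinus 1#) (term′ s) (term′-order s)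
      A-zero : A 0 ≋ zeroS
      A-zero = ≋-trans (⊛-congˡ (term′ s 0) oneMinus-1-0) (⊛-zeroˡ (term′ s 0))
        where
        oneMinus-1-0 : oneMinus 1# 0 ≋ zeroS
        oneMinus-1-0 zero    = -‿inverseʳ 1#
        oneMinus-1-0 (suc N) = -‿inverseʳ 0#

    Φ-recurrence : ∀ s → Φ s ≋ Φ (suc s) ⊕ (recurrenceFactor (z * z) (x * z) s ⊛ Φ (suc (suc s)))
    Φ-recurrence s = ≋-trans (SeriesSolver.solve 2 (λ a b → a := b :+ (a :- b)) ≋-refl (Φ s) (Φ (suc s)))
                             (⊕-cong (≋-refl {Φ (suc s)}) (Φ-difference s))
      where open SeriesSolver using (_:+_; _:-_; _:=_)

    term-zero : ∀ s → term s 0 ≋ E (suc (s ℕ.+ 0))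
    term-zero s = ≋-trans (⊛-cong (⊛-congʳ (P 0 ⊛ E (suc (s ℕ.+ 0))) inv-oneS) Q-zero)
      (≋-trans (⊛-identityʳ _) (≋-trans (⊛-identityʳ _) (⊛-identityˡ _)))
      where
      inv-oneS : inv oneS ≋ oneS
      inv-oneS = ≋-trans (≋-sym (⊛-identityˡ (inv oneS))) (inv-inverseʳ oneS refl)
      mono-1-0 : mono 1# 0 ≋ oneS
      mono-1-0 zero    = refl
      mono-1-0 (suc N) = refl
      Q-zero : Q s 0 ≋ oneS
      Q-zero = ≋-trans (mono-congᵉ 1# (≡.trans (ℕₚ.+-identityʳ (s ℕ.* 0)) (ℕₚ.*-zeroʳ s))) mono-1-0

    Φ-low : ∀ s N → N ≤ s → Φ s N ≈ oneS N
    Φ-low s N N≤s = begin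
      Φ s N                                            ≈⟨ sumBelow-suc (λ n → term s n N) N ⟩
      term s 0 N + sumBelow (λ n → term s (suc n) N) N ≈⟨ +-congˡ (sumBelow-zero _ N higher-terms) ⟩
      term s 0 N + 0#                                  ≈⟨ +-identityʳ _ ⟩
      term s 0 N                                       ≈⟨ term-zero s N ⟩
      E (suc (s ℕ.+ 0)) N                              ≈⟨ poch-low z (suc (s ℕ.+ 0)) (suc N) N<1+s+0 ⟩
      oneS N                                           ∎
      where
      open ≈-Reasoning
      N<1+s+0 : N < suc (s ℕ.+ 0)
      N<1+s+0 = s≤s (ℕₚ.≤-trans N≤s (ℕₚ.m≤m+n s 0))
      higher-terms : ∀ n → n < N → term s (suc n) N ≈ 0#
      higher-terms n _ = ⊛-mono-low (pow z (suc n)) _ _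
        (ℕₚ.≤-<-trans N≤s (ℕₚ.<-≤-trans (ℕₚ.m<m+n s (s≤s z≤n))
          (ℕₚ.+-mono-≤ (ℕₚ.m≤m*n s (suc n)) (n≤tri (suc n)))))

  recurrence-unique : ∀ (C Φ Ψ : ℕ → Series) →
    (∀ s → Φ s ≋ Φ (suc s) ⊕ (C s ⊛ Φ (suc (suc s)))) →
    (∀ s → Ψ s ≋ Ψ (suc s) ⊕ (C s ⊛ Ψ (suc (suc s)))) →
    (∀ s N → N ≤ s → Φ s N ≈ Ψ s N) →
    ∀ s → Φ s ≋ Ψ s
  recurrence-unique C Φ Ψ Φ-rec Ψ-rec low s N = agree N s N (ℕₚ.m≤n+m N s)
    where
    -- Induction on K, since the recurrence expresses the coefficient N of Φ s through
    -- coefficients of index at most N of Φ (suc s) and Φ (suc (suc s)).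
    agree : ∀ K s N → N ≤ s ℕ.+ K → Φ s N ≈ Ψ s N
    agree zero    s N N≤s+0 = low s N (ℕₚ.≤-trans N≤s+0 (ℕₚ.≤-reflexive (ℕₚ.+-identityʳ s)))
    agree (suc K) s N N≤s+1+K = trans (Φ-rec s N) (trans
      (+-cong (agree K (suc s) N N≤1+s+K)
              (⊛-cong-upTo N (λ _ _ → refl) (λ i i≤N → agree K (suc (suc s)) i
                (ℕₚ.≤-trans i≤N (ℕₚ.≤-trans N≤1+s+K (ℕₚ.n≤1+n _))))))
      (sym (Ψ-rec s N)))
      where
      N≤1+s+K : N ≤ suc s ℕ.+ K
      N≤1+s+K = ℕₚ.≤-trans N≤s+1+K (ℕₚ.≤-reflexive (ℕₚ.+-suc s K))

  recurrenceFactor-neg : ∀ x z s →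
    recurrenceFactor ((- z) * (- z)) ((- x) * (- z)) s ≋ recurrenceFactor (z * z) (x * z) s
  recurrenceFactor-neg x z s =
    ⊕-cong (mono-cong _ (-x*-y≈x*y z z)) (⊝-cong (mono-cong (suc s) (-x*-y≈x*y x z)))
    where
    -x*-y≈x*y : ∀ x y → (- x) * (- y) ≈ x * y
    -x*-y≈x*y = Solver.solve 2 (λ x y → (:- x) :* (:- y) := x :* y) refl
      where open Solver using (:-_; _:*_; _:=_)

  LHS≋RHS : ∀ a z → LHS a z ≋ RHS a z
  LHS≋RHS a z = recurrence-unique (recurrenceFactor (z * z) ((z * a) * z)) F⁺.Φ F⁻.Φ F⁺.Φ-recurrence
    (λ s → ≋-trans (F⁻.Φ-recurrence s) (⊕-cong (≋-refl {F⁻.Φ (suc s)})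
      (⊛-congˡ (F⁻.Φ (suc (suc s))) (recurrenceFactor-neg (z * a) z s))))
    (λ s N N≤s → trans (F⁺.Φ-low s N N≤s) (sym (F⁻.Φ-low s N N≤s)))
    0
    where
    module F⁺ = Family (z * a) z
    module F⁻ = Family (- (z * a)) (- z)

theorem1p1 : ∀ {c ℓ : Level} (R : CommutativeRing c ℓ) (a z : CommutativeRing.Carrier R) (N : ℕ) →
    CommutativeRing._≈_ R (PowerSeries.LHS R a z N) (PowerSeries.RHS R a z N)
theorem1p1 R a z = Development.LHS≋RHS R a z
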